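{- Let $k$, $n$ and $s$ be positive integers and let $x_1,\ldots,x_n$ be independent variables. Then $$H_k^{(s)}(x_1,\ldots,x_n)=(-x_n)^{s+1}H_{k-s-1}^{(s)}(x_1,\ldots,x_n)+H_k^{(s)}(x_1,\ldots,x_{n-1})+x_nH_{k-1}^{(s)}(x_1,\ldots,x_{n-1})$$ and $$E_k^{(s)}(x_1,\ldots,x_n)=x_nE_{k-1}^{(s)}(x_1,\ldots,x_n)+E_k^{(s)}(x_1,\ldots,x_{n-1})-x_n^{s+1}E_{k-s-1}^{(s)}(x_1,\ldots,x_{n-1}).$$
   Context: For a positive integer $s$, $H_k^{(s)}$ and $E_k^{(s)}$ ($k\ge0$) are defined by the formal power series identities $$\sum_{k\ge0}H_k^{(s)}(x_1,\ldots,x_n)t^k=\prod_{i=1}^n\big(1-x_it+\cdots+(-x_it)^s\big)^{ -1},\qquad \sum_{k\ge0}E_k^{(s)}(x_1,\ldots,x_n)t^k=\prod_{i=1}^n\big(1+x_it+\cdots+(x_it)^s\big),$$ with $H_j^{(s)}=E_j^{(s)}=0$ for $j<0$; for the empty list of variables (the case $n=1$, $n-1=0$) the empty product gives $H_0^{(s)}=E_0^{(s)}=1$ and $H_j^{(s)}=E_j^{(s)}=0$ for $j\ne0$. -}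

module Defs where

open import Algebra.Bundles using (CommutativeRing)
open import Data.Nat as ℕ using (ℕ; zero; suc; _∸_; _≤ᵇ_)
open import Data.Integer as ℤ using (ℤ; +_; -[1+_])
open import Data.Bool using (if_then_else_)
open import Data.Vec using (Vec; foldr′)

-- Formal power series over a commutative ring R, represented by their
-- coefficient sequences  ℕ → Carrier  (coefficient of t^k).
module PS {c ℓ} (R : CommutativeRing c ℓ) where
  open CommutativeRing R

  Series : Set c
  Series = ℕ → Carrier

  pow : Carrier → ℕ → Carrier
  pow x zero    = 1#
  pow x (suc j) = x * pow x j

  Σ≤ : ℕ → (ℕ → Carrier) → Carrier
  Σ≤ zero    f = f 0
  Σ≤ (suc k) f = Σ≤ k f + f (suc k)

  _⊛_ : Series → Series → Series
  (f ⊛ g) k = Σ≤ k (λ i → f i * g (k ∸ i))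

  one : Series
  one zero    = 1#
  one (suc _) = 0#

  -- Formal inverse of a series f with constant term 1:
  --   g_0 = 1,   g_{k+1} = - Σ_{j=1}^{k+1} f_j g_{k+1-j}.
  -- invUpTo f k agrees with the inverse on all indices ≤ k.
  invUpTo : Series → ℕ → Series
  invUpTo f zero    = one
  invUpTo f (suc k) m =
    if m ≤ᵇ k then invUpTo f k m
    else - Σ≤ k (λ i → f (suc k ∸ i) * invUpTo f k i)

  inv : Series → Series
  inv f k = invUpTo f k k

  hFactor : ℕ → Carrier → Series
  hFactor s x j = if j ≤ᵇ s then pow (- x) j else 0#

  eFactor : ℕ → Carrier → Series
  eFactor s x j = if j ≤ᵇ s then pow x j else 0#

  -- Σ_k H_k^{(s)}(x_1..x_n) t^k = ∏_i (1 - x_i t + ... + (-x_i t)^s)^{-1}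
  Hseries : ∀ {n} → ℕ → Vec Carrier n → Series
  Hseries s xs = foldr′ (λ x acc → inv (hFactor s x) ⊛ acc) one xs

  -- Σ_k E_k^{(s)}(x_1..x_n) t^k = ∏_i (1 + x_i t + ... + (x_i t)^s)
  Eseries : ∀ {n} → ℕ → Vec Carrier n → Series
  Eseries s xs = foldr′ (λ x acc → eFactor s x ⊛ acc) one xs

  -- integer-indexed coefficients, zero for negative indices
  coeffℤ : Series → ℤ → Carrier
  coeffℤ f (+ k)    = f k
  coeffℤ f -[1+ _ ] = 0#

  H : ∀ {n} → ℕ → Vec Carrier n → ℤ → Carrier
  H s xs = coeffℤ (Hseries s xs)

  E : ∀ {n} → ℕ → Vec Carrier n → ℤ → Carrier
  E s xs = coeffℤ (Eseries s xs)

-- The truncated geometric sums satisfy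
--   (1 + x t)(1 - x t + ⋯ + (-x t)ˢ) = 1 - (-x t)ˢ⁺¹   and   (1 - x t)(1 + x t + ⋯ + (x t)ˢ) = 1 - (x t)ˢ⁺¹.
-- Multiplying the generating functions by these binomials removes the last variable:
--   (1 - (-xₙ t)ˢ⁺¹) Σₖ Hₖ(x₁,…,xₙ) tᵏ = (1 + xₙ t) Σₖ Hₖ(x₁,…,xₙ₋₁) tᵏ,
--   (1 - xₙ t) Σₖ Eₖ(x₁,…,xₙ) tᵏ = (1 - (xₙ t)ˢ⁺¹) Σₖ Eₖ(x₁,…,xₙ₋₁) tᵏ,
-- and comparing coefficients of tᵏ gives both recurrences. Multiplication by a binomial
-- 1 + a tᵈ commutes with the Cauchy product.
module Submission where

open import Defs
open import Algebra.Bundles using (CommutativeRing)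
open import Data.Bool using (true; false; if_then_else_)
open import Data.Empty using (⊥-elim)
open import Data.Integer as ℤ using (+_; _⊖_)
open import Data.Integer.Properties using ([1+m]⊖[1+n]≡m⊖n)
open import Data.Nat using (ℕ; zero; suc; _≤_; _<_; z≤n; s≤s; _∸_; _≤ᵇ_)
open import Data.Nat.Properties
  using (≤-refl; <⇒≤; <⇒≱; n<1+n; m<n⇒m<1+n; m≤n⇒m≤1+n; m≤n⇒m<n∨m≡n; m<1+n⇒m≤n;
         +-∸-assoc; n∸n≡0; <-cmp; ≤⇒≤ᵇ; ≤ᵇ⇒≤)
open import Data.Product using (_×_; _,_)
open import Data.Sum using (inj₁; inj₂)
open import Data.Vec using (Vec; []; _∷_; _∷ʳ_; foldr′)
open import Relation.Binary using (tri<; tri≈; tri>)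
open import Relation.Binary.PropositionalEquality as ≡ using (_≡_)

module _ {a} {A : Set a} {x y : A} where

  if-≤ᵇ-true : ∀ {m n} → m ≤ n → (if m ≤ᵇ n then x else y) ≡ x
  if-≤ᵇ-true {m} {n} m≤n with m ≤ᵇ n | ≤⇒≤ᵇ m≤n
  ... | true | _ = ≡.refl

  if-≤ᵇ-false : ∀ {m n} → n < m → (if m ≤ᵇ n then x else y) ≡ y
  if-≤ᵇ-false {m} {n} n<m with m ≤ᵇ n | ≤ᵇ⇒≤ m n
  ... | false | _   = ≡.refl
  ... | true  | m≤n = ⊥-elim (<⇒≱ n<m (m≤n _))

module SeriesProperties {c ℓ} (R : CommutativeRing c ℓ) where
  open CommutativeRing R hiding (zero)
  open PS R
  open import Relation.Binary.Reasoning.Setoid setoid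
  open import Algebra.Properties.Ring ring using (-‿distribˡ-*; -‿involutive)
  open import Algebra.Properties.CommutativeSemigroup +-commutativeSemigroup using (interchange)
  open import Algebra.Properties.CommutativeSemigroup *-commutativeSemigroup using (x∙yz≈y∙xz)

  infix 4 _≋_
  _≋_ : Series → Series → Set ℓ
  f ≋ g = ∀ k → f k ≈ g k

  Σ≤-cong : ∀ k {f g} → (∀ i → i ≤ k → f i ≈ g i) → Σ≤ k f ≈ Σ≤ k g
  Σ≤-cong zero    f≈g = f≈g 0 z≤n
  Σ≤-cong (suc k) f≈g =
    +-cong (Σ≤-cong k (λ i i≤k → f≈g i (m≤n⇒m≤1+n i≤k))) (f≈g (suc k) ≤-refl)

  Σ≤-zero : ∀ k {f} → (∀ i → i ≤ k → f i ≈ 0#) → Σ≤ k f ≈ 0#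
  Σ≤-zero zero    f≈0 = f≈0 0 z≤n
  Σ≤-zero (suc k) f≈0 = begin
    Σ≤ k _ + _ ≈⟨ +-cong (Σ≤-zero k (λ i i≤k → f≈0 i (m≤n⇒m≤1+n i≤k))) (f≈0 (suc k) ≤-refl) ⟩
    0# + 0#    ≈⟨ +-identityʳ 0# ⟩
    0#         ∎

  Σ≤-+ : ∀ k f g → Σ≤ k (λ i → f i + g i) ≈ Σ≤ k f + Σ≤ k g
  Σ≤-+ zero    f g = refl
  Σ≤-+ (suc k) f g = trans (+-congʳ (Σ≤-+ k f g)) (interchange _ _ _ _)

  Σ≤-*ˡ : ∀ k a f → Σ≤ k (λ i → a * f i) ≈ a * Σ≤ k f
  Σ≤-*ˡ zero    a f = refl
  Σ≤-*ˡ (suc k) a f = trans (+-congʳ (Σ≤-*ˡ k a f)) (sym (distribˡ a _ _))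

  shift₁ : Series → Series
  shift₁ f zero    = 0#
  shift₁ f (suc k) = f k

  shift : ℕ → Series → Series
  shift zero    f = f
  shift (suc d) f = shift₁ (shift d f)

  shift-< : ∀ d f {k} → k < d → shift d f k ≡ 0#
  shift-< (suc d) f {zero}  _         = ≡.refl
  shift-< (suc d) f {suc k} (s≤s k<d) = shift-< d f k<d

  shift-self : ∀ d f → shift d f d ≡ f 0
  shift-self zero    f = ≡.refl
  shift-self (suc d) f = shift-self d f

  shift-one-> : ∀ d {k} → d < k → shift d one k ≡ 0#
  shift-one-> zero    {suc k} _         = ≡.refl
  shift-one-> (suc d) {suc k} (s≤s d<k) = shift-one-> d d<k

  shift-cong : ∀ d {f g} → f ≋ g → shift d f ≋ shift d g
  shift-cong zero    f≋g k       = f≋g k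
  shift-cong (suc d) f≋g zero    = refl
  shift-cong (suc d) f≋g (suc k) = shift-cong d f≋g k

  coeffℤ-⊖ : ∀ f k d → coeffℤ f (k ⊖ d) ≡ shift d f k
  coeffℤ-⊖ f k       zero    = ≡.refl
  coeffℤ-⊖ f zero    (suc d) = ≡.refl
  coeffℤ-⊖ f (suc k) (suc d) = ≡.trans (≡.cong (coeffℤ f) ([1+m]⊖[1+n]≡m⊖n k d)) (coeffℤ-⊖ f k d)

  ⊛-congʳ : ∀ u {f g} → f ≋ g → u ⊛ f ≋ u ⊛ g
  ⊛-congʳ u f≋g k = Σ≤-cong k (λ i _ → *-congˡ (f≋g (k ∸ i)))

  ⊛-identityʳ : ∀ u → u ⊛ one ≋ u
  ⊛-identityʳ u zero    = *-identityʳ (u 0)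
  ⊛-identityʳ u (suc k) = begin
    Σ≤ k (λ i → u i * one (suc k ∸ i)) + u (suc k) * one (k ∸ k)
      ≈⟨ +-cong (Σ≤-zero k (λ i i≤k → trans (*-congˡ (reflexive (≡.cong one (+-∸-assoc 1 i≤k))))
                                            (zeroʳ (u i))))
                (*-congˡ (reflexive (≡.cong one (n∸n≡0 k)))) ⟩
    0# + u (suc k) * 1#  ≈⟨ +-identityˡ _ ⟩
    u (suc k) * 1#       ≈⟨ *-identityʳ _ ⟩
    u (suc k)            ∎

  ⊛-shift₁ : ∀ u f → u ⊛ shift₁ f ≋ shift₁ (u ⊛ f)
  ⊛-shift₁ u f zero    = zeroʳ (u 0)
  ⊛-shift₁ u f (suc k) = begin
    Σ≤ k (λ i → u i * shift₁ f (suc k ∸ i)) + u (suc k) * shift₁ f (k ∸ k)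
      ≈⟨ +-cong (Σ≤-cong k (λ i i≤k → *-congˡ (reflexive (≡.cong (shift₁ f) (+-∸-assoc 1 i≤k)))))
                (*-congˡ (reflexive (≡.cong (shift₁ f) (n∸n≡0 k)))) ⟩
    (u ⊛ f) k + u (suc k) * 0#  ≈⟨ +-congˡ (zeroʳ _) ⟩
    (u ⊛ f) k + 0#              ≈⟨ +-identityʳ _ ⟩
    (u ⊛ f) k                   ∎

  ⊛-shift : ∀ d u f → u ⊛ shift d f ≋ shift d (u ⊛ f)
  ⊛-shift zero    u f k       = refl
  ⊛-shift (suc d) u f zero    = ⊛-shift₁ u (shift d f) zero
  ⊛-shift (suc d) u f (suc k) = trans (⊛-shift₁ u (shift d f) (suc k)) (⊛-shift d u f k)

  -- (1 + a tᵈ) · f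
  mul1+ : Carrier → ℕ → Series → Series
  mul1+ a d f k = f k + a * shift d f k

  mul1+-cong : ∀ {a b} d {f g} → a ≈ b → f ≋ g → mul1+ a d f ≋ mul1+ b d g
  mul1+-cong d a≈b f≋g k = +-cong (f≋g k) (*-cong a≈b (shift-cong d f≋g k))

  ⊛-mul1+ : ∀ a d u f → u ⊛ mul1+ a d f ≋ mul1+ a d (u ⊛ f)
  ⊛-mul1+ a d u f k = begin
    Σ≤ k (λ i → u i * (f (k ∸ i) + a * shift d f (k ∸ i)))
      ≈⟨ Σ≤-cong k (λ i _ → trans (distribˡ _ _ _) (+-congˡ (x∙yz≈y∙xz _ a _))) ⟩
    Σ≤ k (λ i → u i * f (k ∸ i) + a * (u i * shift d f (k ∸ i)))
      ≈⟨ Σ≤-+ k _ _ ⟩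
    (u ⊛ f) k + Σ≤ k (λ i → a * (u i * shift d f (k ∸ i)))
      ≈⟨ +-congˡ (Σ≤-*ˡ k a _) ⟩
    (u ⊛ f) k + a * (u ⊛ shift d f) k
      ≈⟨ +-congˡ (*-congˡ (⊛-shift d u f k)) ⟩
    (u ⊛ f) k + a * shift d (u ⊛ f) k ∎

  eFactor-geometric : ∀ s y → mul1+ (- y) 1 (eFactor s y) ≋ mul1+ (- pow y (suc s)) (suc s) one
  eFactor-geometric s y zero = +-congˡ (trans (zeroʳ (- y)) (sym (zeroʳ _)))
  eFactor-geometric s y (suc j) with <-cmp j s
  ... | tri< j<s _ _ = begin
    eFactor s y (suc j) + - y * eFactor s y j
      ≈⟨ +-cong (reflexive (if-≤ᵇ-true j<s)) (*-congˡ (reflexive (if-≤ᵇ-true (<⇒≤ j<s)))) ⟩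
    y * pow y j + - y * pow y j  ≈⟨ +-congˡ (sym (-‿distribˡ-* y _)) ⟩
    y * pow y j + - (y * pow y j) ≈⟨ -‿inverseʳ _ ⟩
    0#                            ≈⟨ sym (zeroʳ _) ⟩
    - pow y (suc s) * 0#          ≈⟨ sym (+-identityˡ _) ⟩
    0# + - pow y (suc s) * 0#     ≈⟨ +-congˡ (*-congˡ (reflexive (≡.sym (shift-< s one j<s)))) ⟩
    0# + - pow y (suc s) * shift s one j ∎
  ... | tri≈ _ ≡.refl _ = begin
    eFactor j y (suc j) + - y * eFactor j y j
      ≈⟨ +-cong (reflexive (if-≤ᵇ-false (n<1+n j))) (*-congˡ (reflexive (if-≤ᵇ-true (≤-refl {j})))) ⟩
    0# + - y * pow y j             ≈⟨ +-identityˡ _ ⟩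
    - y * pow y j                  ≈⟨ -‿distribˡ-* y _ ⟨
    - pow y (suc j)                ≈⟨ sym (*-identityʳ _) ⟩
    - pow y (suc j) * 1#           ≈⟨ sym (+-identityˡ _) ⟩
    0# + - pow y (suc j) * 1#      ≈⟨ +-congˡ (*-congˡ (reflexive (≡.sym (shift-self j one)))) ⟩
    0# + - pow y (suc j) * shift j one j ∎
  ... | tri> _ _ s<j = begin
    eFactor s y (suc j) + - y * eFactor s y j
      ≈⟨ +-cong (reflexive (if-≤ᵇ-false (m<n⇒m<1+n s<j))) (*-congˡ (reflexive (if-≤ᵇ-false s<j))) ⟩
    0# + - y * 0#                  ≈⟨ +-congˡ (trans (zeroʳ _) (sym (zeroʳ _))) ⟩
    0# + - pow y (suc s) * 0#      ≈⟨ +-congˡ (*-congˡ (reflexive (≡.sym (shift-one-> s s<j)))) ⟩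
    0# + - pow y (suc s) * shift s one j ∎

  invUpTo-stable : ∀ f {k m} → m ≤ k → invUpTo f k m ≡ inv f m
  invUpTo-stable f {zero} z≤n = ≡.refl
  invUpTo-stable f {suc k} m≤1+k with m≤n⇒m<n∨m≡n m≤1+k
  ... | inj₁ m<1+k  = ≡.trans (if-≤ᵇ-true (m<1+n⇒m≤n m<1+k)) (invUpTo-stable f (m<1+n⇒m≤n m<1+k))
  ... | inj₂ ≡.refl = ≡.refl

  inv-suc : ∀ f k → inv f (suc k) ≈ - Σ≤ k (λ i → f (suc k ∸ i) * inv f i)
  inv-suc f k = trans (reflexive (if-≤ᵇ-false (n<1+n k)))
    (-‿cong (Σ≤-cong k (λ i i≤k → *-congˡ (reflexive (invUpTo-stable f i≤k)))))

  inv-inverseˡ : ∀ f → f 0 ≈ 1# → inv f ⊛ f ≋ one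
  inv-inverseˡ f f0≈1 zero    = trans (*-identityˡ _) f0≈1
  inv-inverseˡ f f0≈1 (suc k) = begin
    Σ≤ k (λ i → inv f i * f (suc k ∸ i)) + inv f (suc k) * f (k ∸ k)
      ≈⟨ +-cong (Σ≤-cong k (λ i _ → *-comm _ _))
                (trans (*-congˡ (trans (reflexive (≡.cong f (n∸n≡0 k))) f0≈1)) (*-identityʳ _)) ⟩
    S + inv f (suc k)  ≈⟨ +-congˡ (inv-suc f k) ⟩
    S + - S            ≈⟨ -‿inverseʳ S ⟩
    0#                 ∎
    where S = Σ≤ k (λ i → f (suc k ∸ i) * inv f i)

  prod : (Carrier → Series) → ∀ {n} → Vec Carrier n → Series → Series
  prod φ xs b = foldr′ (λ x acc → φ x ⊛ acc) b xs

  prod-∷ʳ : ∀ φ {n} (xs : Vec Carrier n) x b → prod φ (xs ∷ʳ x) b ≡ prod φ xs (φ x ⊛ b)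
  prod-∷ʳ φ []       x b = ≡.refl
  prod-∷ʳ φ (y ∷ xs) x b = ≡.cong (φ y ⊛_) (prod-∷ʳ φ xs x b)

  prod-congʳ : ∀ φ {n} (xs : Vec Carrier n) {b b′} → b ≋ b′ → prod φ xs b ≋ prod φ xs b′
  prod-congʳ φ []       b≋b′ = b≋b′
  prod-congʳ φ (x ∷ xs) b≋b′ = ⊛-congʳ (φ x) (prod-congʳ φ xs b≋b′)

  mul1+-prod : ∀ a d φ {n} (xs : Vec Carrier n) b → mul1+ a d (prod φ xs b) ≋ prod φ xs (mul1+ a d b)
  mul1+-prod a d φ []       b k = refl
  mul1+-prod a d φ (x ∷ xs) b k =
    trans (sym (⊛-mul1+ a d (φ x) _ k)) (⊛-congʳ (φ x) (mul1+-prod a d φ xs b) k)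

  mul1+-prod-∷ʳ : ∀ φ {n} (xs : Vec Carrier n) x {a d b e} →
    mul1+ a d (φ x ⊛ one) ≋ mul1+ b e one →
    mul1+ a d (prod φ (xs ∷ʳ x) one) ≋ mul1+ b e (prod φ xs one)
  mul1+-prod-∷ʳ φ xs x {a} {d} {b} {e} last k rewrite prod-∷ʳ φ xs x one = begin
    mul1+ a d (prod φ xs (φ x ⊛ one)) k   ≈⟨ mul1+-prod a d φ xs _ k ⟩
    prod φ xs (mul1+ a d (φ x ⊛ one)) k   ≈⟨ prod-congʳ φ xs last k ⟩
    prod φ xs (mul1+ b e one) k           ≈⟨ mul1+-prod b e φ xs one k ⟨
    mul1+ b e (prod φ xs one) k           ∎

  inv-hFactor-binomial : ∀ s x →
    mul1+ (- pow (- x) (suc s)) (suc s) (inv (hFactor s x) ⊛ one) ≋ mul1+ x 1 one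
  inv-hFactor-binomial s x k = begin
    mul1+ (- pow (- x) (suc s)) (suc s) (g ⊛ one) k  ≈⟨ ⊛-mul1+ _ (suc s) g one k ⟨
    (g ⊛ mul1+ (- pow (- x) (suc s)) (suc s) one) k  ≈⟨ ⊛-congʳ g (eFactor-geometric s (- x)) k ⟨
    (g ⊛ mul1+ (- - x) 1 (hFactor s x)) k            ≈⟨ ⊛-congʳ g (mul1+-cong 1 (-‿involutive x) (λ _ → refl)) k ⟩
    (g ⊛ mul1+ x 1 (hFactor s x)) k                  ≈⟨ ⊛-mul1+ x 1 g (hFactor s x) k ⟩
    mul1+ x 1 (g ⊛ hFactor s x) k                    ≈⟨ mul1+-cong 1 refl (inv-inverseˡ (hFactor s x) refl) k ⟩
    mul1+ x 1 one k                                  ∎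
    where g = inv (hFactor s x)

  eFactor-binomial : ∀ s x → mul1+ (- x) 1 (eFactor s x ⊛ one) ≋ mul1+ (- pow x (suc s)) (suc s) one
  eFactor-binomial s x k =
    trans (mul1+-cong 1 refl (⊛-identityʳ (eFactor s x)) k) (eFactor-geometric s x k)

  Hseries-∷ʳ : ∀ s {n} (xs : Vec Carrier n) x →
    mul1+ (- pow (- x) (suc s)) (suc s) (Hseries s (xs ∷ʳ x)) ≋ mul1+ x 1 (Hseries s xs)
  Hseries-∷ʳ s xs x = mul1+-prod-∷ʳ (λ y → inv (hFactor s y)) xs x {d = suc s} {e = 1} (inv-hFactor-binomial s x)

  Eseries-∷ʳ : ∀ s {n} (xs : Vec Carrier n) x →
    mul1+ (- x) 1 (Eseries s (xs ∷ʳ x)) ≋ mul1+ (- pow x (suc s)) (suc s) (Eseries s xs)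
  Eseries-∷ʳ s xs x = mul1+-prod-∷ʳ (eFactor s) xs x {d = 1} {e = suc s} (eFactor-binomial s x)

  x+-p*q≈v⇒x≈p*q+v : ∀ {x v} p q → x + - p * q ≈ v → x ≈ p * q + v
  x+-p*q≈v⇒x≈p*q+v {x} {v} p q eq = begin
    x                              ≈⟨ +-identityʳ x ⟨
    x + 0#                         ≈⟨ +-congˡ (-‿inverseˡ (p * q)) ⟨
    x + (- (p * q) + p * q)        ≈⟨ +-congˡ (+-congʳ (-‿distribˡ-* p q)) ⟩
    x + (- p * q + p * q)          ≈⟨ +-assoc x _ _ ⟨
    (x + - p * q) + p * q          ≈⟨ +-congʳ eq ⟩
    v + p * q                      ≈⟨ +-comm v _ ⟩
    p * q + v                      ∎

  H-recurrence : ∀ s {n} (xs : Vec Carrier n) x k →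
    H s (xs ∷ʳ x) (+ k)
      ≈ pow (- x) (suc s) * H s (xs ∷ʳ x) (k ⊖ suc s) + H s xs (+ k) + x * H s xs (k ⊖ 1)
  H-recurrence s xs x k = begin
    F k                                                      ≈⟨ x+-p*q≈v⇒x≈p*q+v _ _ (Hseries-∷ʳ s xs x k) ⟩
    pow (- x) (suc s) * shift (suc s) F k + (G k + x * shift 1 G k) ≈⟨ +-assoc _ _ _ ⟨
    pow (- x) (suc s) * shift (suc s) F k + G k + x * shift 1 G k   ≡⟨ ≡.cong₂ (λ u v → pow (- x) (suc s) * u + G k + x * v)
                                                                         (≡.sym (coeffℤ-⊖ F k (suc s))) (≡.sym (coeffℤ-⊖ G k 1)) ⟩
    pow (- x) (suc s) * H s (xs ∷ʳ x) (k ⊖ suc s) + G k + x * H s xs (k ⊖ 1) ∎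
    where F = Hseries s (xs ∷ʳ x); G = Hseries s xs

  E-recurrence : ∀ s {n} (xs : Vec Carrier n) x k →
    E s (xs ∷ʳ x) (+ k)
      ≈ x * E s (xs ∷ʳ x) (k ⊖ 1) + E s xs (+ k) - pow x (suc s) * E s xs (k ⊖ suc s)
  E-recurrence s xs x k = begin
    F k                                                        ≈⟨ x+-p*q≈v⇒x≈p*q+v _ _ (Eseries-∷ʳ s xs x k) ⟩
    x * shift 1 F k + (G k + - pow x (suc s) * shift (suc s) G k) ≈⟨ +-assoc _ _ _ ⟨
    x * shift 1 F k + G k + - pow x (suc s) * shift (suc s) G k   ≈⟨ +-congˡ (-‿distribˡ-* _ _) ⟨
    x * shift 1 F k + G k - pow x (suc s) * shift (suc s) G k     ≡⟨ ≡.cong₂ (λ u v → x * u + G k - pow x (suc s) * v)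
                                                                       (≡.sym (coeffℤ-⊖ F k 1)) (≡.sym (coeffℤ-⊖ G k (suc s))) ⟩
    x * E s (xs ∷ʳ x) (k ⊖ 1) + G k - pow x (suc s) * E s xs (k ⊖ suc s) ∎
    where F = Eseries s (xs ∷ʳ x); G = Eseries s xs

-- The recurrences hold for every k and s.
theorem2p9 : ∀ {c ℓ} (R : CommutativeRing c ℓ) (k m s : ℕ) → 1 ≤ k → 1 ≤ s →
  (xs : Vec (CommutativeRing.Carrier R) m) (xn : CommutativeRing.Carrier R) →
  let open CommutativeRing R
      open PS R
  in (H s (xs ∷ʳ xn) (+ k)
        ≈ pow (- xn) (suc s) * H s (xs ∷ʳ xn) (+ k ℤ.- + suc s)
          + H s xs (+ k) + xn * H s xs (+ k ℤ.- + 1))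
   × (E s (xs ∷ʳ xn) (+ k)
        ≈ xn * E s (xs ∷ʳ xn) (+ k ℤ.- + 1) + E s xs (+ k)
          - pow xn (suc s) * E s xs (+ k ℤ.- + suc s))
theorem2p9 R k m s _ _ xs xn = H-recurrence s xs xn k , E-recurrence s xs xn k
  where open SeriesProperties R
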